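{- Let $L$ be a hitomezashi loop, and let $a$ be a longitude at which $L$ has at least one horizontal stitch. Then the difference in latitude between any two consecutive stitches of $L$ at longitude $a$ is an odd integer. Moreover, the difference in latitude between the north-most and south-most stitches of $L$ at longitude $a$ is an odd integer. The analogous statements hold for vertical stitches (with the roles of longitude and latitude exchanged).
   Context: A hitomezashi pattern is determined by labels $\epsilon_i\in\{0,1\}$ for every integer $i$ and $\eta_j\in\{0,1\}$ for every integer $j$. Its vertical stitches are the unit segments from $(i,j)$ to $(i,j+1)$ for all integers $i,j$ with $j\equiv \epsilon_i \pmod 2$; its horizontal stitches are the unit segments from $(i,j)$ to $(i+1,j)$ for all integers $i,j$ with $i\equiv \eta_j\pmod 2$. A hitomezashi loop is a simple closed curve that is a union of stitches of some hitomezashi pattern. Each unit segment is coordinatized by its midpoint: its longitude is the $x$-coordinate and its latitude is the $y$-coordinate of its midpoint (so a horizontal stitch from $(i,j)$ to $(i+1,j)$ has longitude $i+1/2$ and latitude $j$). Two stitches of $L$ with longitude $a$ are consecutive if no other stitch of $L$ with longitude $a$ has latitude strictly between theirs. -}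

module Defs where

open import Data.Bool.Base using (Bool; true; false)
open import Data.Nat.Base as ℕ using (ℕ; suc)
open import Data.Integer.Base using (ℤ; +_; _+_; _-_; _*_; _<_; _≤_)
open import Data.Product.Base using (Σ; ∃; ∃-syntax; _×_; _,_)
open import Data.Sum.Base using (_⊎_)
open import Relation.Binary.PropositionalEquality using (_≡_)
open import Relation.Nullary using (¬_)

Point : Set
Point = ℤ × ℤ

bitℤ : Bool → ℤ
bitℤ false = + 0
bitℤ true  = + 1

_≡₂_ : ℤ → ℤ → Set
x ≡₂ y = ∃[ k ] x ≡ y + (+ 2) * k

Odd : ℤ → Set
Odd d = ∃[ k ] d ≡ + 1 + (+ 2) * k

record Pattern : Set where
  field
    ε : ℤ → Bool
    η : ℤ → Bool
open Pattern public

-- The vertical segment from (i,j) to (i,j+1) is a stitch iff j ≡ ε_i (mod 2).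
IsVStitch : Pattern → ℤ → ℤ → Set
IsVStitch P i j = j ≡₂ bitℤ (ε P i)

-- The horizontal segment from (i,j) to (i+1,j) is a stitch iff i ≡ η_j (mod 2).
IsHStitch : Pattern → ℤ → ℤ → Set
IsHStitch P i j = i ≡₂ bitℤ (η P j)

StitchBetween : Pattern → Point → Point → Set
StitchBetween P (x , y) (x' , y') =
    (x' ≡ x + + 1 × y' ≡ y × IsHStitch P x y)
  ⊎ (x ≡ x' + + 1 × y ≡ y' × IsHStitch P x' y)
  ⊎ (x' ≡ x × y' ≡ y + + 1 × IsVStitch P x y)
  ⊎ (x ≡ x' × y ≡ y' + + 1 × IsVStitch P x y')

-- A hitomezashi loop of P: a simple closed curve made of stitches of P,
-- i.e. a cycle v 0, v 1, …, v (n-1), v n = v 0 in the lattice with n ≥ 3,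
-- pairwise distinct vertices v 0 … v (n-1), and each segment
-- v k — v (k+1) a stitch of P. (v is given on all of ℕ, n-periodic.)
record HitomezashiLoop (P : Pattern) : Set where
  field
    n        : ℕ
    n≥3      : 3 ℕ.≤ n
    v        : ℕ → Point
    periodic : ∀ k → v (k ℕ.+ n) ≡ v k
    simple   : ∀ k l → k ℕ.< n → l ℕ.< n → v k ≡ v l → k ≡ l
    stitches : ∀ k → StitchBetween P (v k) (v (suc k))
open HitomezashiLoop public

EdgeOf : ∀ {P} → HitomezashiLoop P → Point → Point → Set
EdgeOf L p q = ∃[ k ] (k ℕ.< n L) × ((v L k ≡ p × v L (suc k) ≡ q) ⊎ (v L k ≡ q × v L (suc k) ≡ p))

-- L contains the horizontal stitch from (i,j) to (i+1,j);
-- it has longitude i + 1/2 and latitude j.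
HStitchOf : ∀ {P} → HitomezashiLoop P → ℤ → ℤ → Set
HStitchOf L i j = EdgeOf L (i , j) (i + + 1 , j)

-- L contains the vertical stitch from (i,j) to (i,j+1);
-- it has longitude i and latitude j + 1/2.
VStitchOf : ∀ {P} → HitomezashiLoop P → ℤ → ℤ → Set
VStitchOf L i j = EdgeOf L (i , j) (i , j + + 1)

-- Orient the loop. The cell on the left of each edge lies on one fixed side of the loop and has
-- one fixed checkerboard colour: at a corner, consecutive left cells either coincide or are joined
-- through the corner cell across two segments that, since stitches alternate along every line, are
-- not stitches; and both the checkerboard colour and the inside indicator change by a constant
-- across every non-stitch. The left cell of a horizontal stitch is the cell just above or just below
-- it. If the cell just above one stitch in a column and the cell just below a higher one lie on the
-- same side of the loop (as they do for consecutive stitches, and for the lowest and the highest),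
-- one of the two stitches therefore has its left cell above it and the other below, and equality of
-- colours makes their latitudes differ by an odd number. Inside is the parity of the number of
-- stitches below a cell in its column; that it changes only across stitches of the loop is Stokes'
-- theorem mod 2 for the closed loop. Vertical stitches follow by transposing the pattern.
module Submission where

open import Data.Bool.Base using (Bool; true; false; not; _∧_; _xor_)
open import Data.Bool.Properties
  using ( not-involutive; not-¬; ¬-not; xor-comm; xor-assoc; xor-same; xor-identityʳ; xor-inverseˡ
        ; ∧-zeroʳ; ∧-identityʳ; not-distribˡ-xor; not-distribʳ-xor; xor-annihilates-not; ∧-distribˡ-xor
        ; xor-∧-commutativeRing)
open import Algebra.Bundles using (CommutativeRing)
open import Algebra.Properties.CommutativeSemigroup
  (CommutativeRing.+-commutativeSemigroup xor-∧-commutativeRing) using (interchange)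
open import Algebra.Properties.Group (CommutativeRing.+-group xor-∧-commutativeRing)
  using () renaming (∙-cancelˡ to xor-cancelˡ)
open import Data.Empty using (⊥; ⊥-elim)
open import Data.Integer.Base using (ℤ; +_; -[1+_]; _+_; _-_; -_; _*_; _<_; _≤_)
open import Data.Integer.DivMod using (_%ℕ_; _/ℕ_; a≡a%ℕn+[a/ℕn]*n; n%ℕd<d)
import Data.Integer.Properties as ℤ
open import Data.Integer.Tactic.RingSolver using (solve-∀)
open import Data.Nat.Base as ℕ using (ℕ; zero; suc; s≤s)
import Data.Nat.Properties as ℕ
open import Data.Product.Base using (∃-syntax; _×_; _,_; proj₁; swap)
open import Data.Sum.Base using (_⊎_; inj₁; inj₂)
open import Function.Base using (_∘_)
open import Relation.Binary.PropositionalEquality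
open import Relation.Binary.Definitions using (tri<; tri≈; tri>)
open import Relation.Nullary using (¬_; does; yes; no; contradiction)
open import Relation.Nullary.Decidable using (dec-true; dec-false)

open import Defs

xor≡false⇒≡ : ∀ {x y} → x xor y ≡ false → x ≡ y
xor≡false⇒≡ {x} {y} eq = sym (xor-cancelˡ x y x (trans eq (sym (xor-same x))))

xor-cancel-middle : ∀ x y z → (x xor y) xor (y xor z) ≡ x xor z
xor-cancel-middle x y z = begin
  (x xor y) xor (y xor z)  ≡⟨ xor-assoc x y (y xor z) ⟩
  x xor (y xor (y xor z))  ≡⟨ cong (x xor_) (sym (xor-assoc y y z)) ⟩
  x xor ((y xor y) xor z)  ≡⟨ cong (λ b → x xor (b xor z)) (xor-same y) ⟩
  x xor z                  ∎
  where open ≡-Reasoning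

isOddℕ : ℕ → Bool
isOddℕ zero    = false
isOddℕ (suc n) = not (isOddℕ n)

isOdd : ℤ → Bool
isOdd (+ n)    = isOddℕ n
isOdd -[1+ n ] = not (isOddℕ n)

isOdd-suc : ∀ a → isOdd (a + + 1) ≡ not (isOdd a)
isOdd-suc (+ n)          = cong isOddℕ (ℕ.+-comm n 1)
isOdd-suc -[1+ zero ]    = refl
isOdd-suc -[1+ suc n ]   = sym (not-involutive _)

isOdd-pred : ∀ a → isOdd (a - + 1) ≡ not (isOdd a)
isOdd-pred (+ zero)   = refl
isOdd-pred (+ suc n)  = sym (not-involutive _)
isOdd-pred -[1+ n ]   = cong (not ∘ not ∘ isOddℕ) (ℕ.+-identityʳ n)

isOdd-+ : ∀ a b → isOdd (a + b) ≡ isOdd a xor isOdd b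
isOdd-+ a (+ zero)        = trans (cong isOdd (ℤ.+-identityʳ a)) (sym (xor-identityʳ _))
isOdd-+ a (+ suc n)       = begin
  isOdd (a + + suc n)           ≡⟨ cong isOdd (sym (ℤ.+-assoc a (+ 1) (+ n))) ⟩
  isOdd (a + + 1 + + n)         ≡⟨ isOdd-+ (a + + 1) (+ n) ⟩
  isOdd (a + + 1) xor isOddℕ n  ≡⟨ cong (_xor isOddℕ n) (isOdd-suc a) ⟩
  not (isOdd a) xor isOddℕ n    ≡⟨ sym (not-distribˡ-xor (isOdd a) (isOddℕ n)) ⟩
  not (isOdd a xor isOddℕ n)    ≡⟨ not-distribʳ-xor (isOdd a) (isOddℕ n) ⟩
  isOdd a xor not (isOddℕ n)    ∎
  where open ≡-Reasoning
isOdd-+ a -[1+ zero ]     = trans (isOdd-pred a) (sym (xor-comm _ true))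
isOdd-+ a -[1+ suc n ]    = begin
  isOdd (a + -[1+ suc n ])             ≡⟨ cong isOdd (sym (ℤ.+-assoc a -[1+ 0 ] -[1+ n ])) ⟩
  isOdd (a - + 1 + -[1+ n ])           ≡⟨ isOdd-+ (a - + 1) -[1+ n ] ⟩
  isOdd (a - + 1) xor not (isOddℕ n)   ≡⟨ cong (_xor not (isOddℕ n)) (isOdd-pred a) ⟩
  not (isOdd a) xor not (isOddℕ n)     ≡⟨ xor-annihilates-not (isOdd a) (isOddℕ n) ⟩
  isOdd a xor isOddℕ n                 ≡⟨ cong (isOdd a xor_) (sym (not-involutive (isOddℕ n))) ⟩
  isOdd a xor not (not (isOddℕ n))     ∎
  where open ≡-Reasoning

isOdd-neg : ∀ a → isOdd (- a) ≡ isOdd a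
isOdd-neg (+ zero)  = refl
isOdd-neg (+ suc n) = refl
isOdd-neg -[1+ n ]  = refl

isOdd-2* : ∀ k → isOdd (+ 2 * k) ≡ false
isOdd-2* k = begin
  isOdd (+ 2 * k)         ≡⟨ cong isOdd (2*k≡k+k k) ⟩
  isOdd (k + k)           ≡⟨ isOdd-+ k k ⟩
  isOdd k xor isOdd k     ≡⟨ xor-same (isOdd k) ⟩
  false                   ∎
  where
  open ≡-Reasoning
  2*k≡k+k : ∀ k → + 2 * k ≡ k + k
  2*k≡k+k = solve-∀

≡₂⇒isOdd-≡ : ∀ {x y} → x ≡₂ y → isOdd x ≡ isOdd y
≡₂⇒isOdd-≡ {y = y} (k , refl) = trans (isOdd-+ y (+ 2 * k)) (trans (cong (isOdd y xor_) (isOdd-2* k)) (xor-identityʳ (isOdd y)))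

¬adjacent-≡₂ : ∀ {x x′ t} → x′ ≡ x + + 1 → x ≡₂ t → x′ ≡₂ t → ⊥
¬adjacent-≡₂ {x} {t = t} refl x≡t x+1≡t = not-¬ refl (begin
  isOdd x            ≡⟨ ≡₂⇒isOdd-≡ {y = t} x≡t ⟩
  isOdd t            ≡⟨ ≡₂⇒isOdd-≡ {y = t} x+1≡t ⟨
  isOdd (x + + 1)    ≡⟨ isOdd-suc x ⟩
  not (isOdd x)      ∎)
  where open ≡-Reasoning

isOdd⇒Odd : ∀ d → isOdd d ≡ true → Odd d
isOdd⇒Odd d odd = byRemainder (d %ℕ 2) (n%ℕd<d d 2) (a≡a%ℕn+[a/ℕn]*n d 2)
  where
  q : ℤ
  q = d /ℕ 2
  even-form : ∀ q → + 0 + q * + 2 ≡ + 2 * q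
  even-form = solve-∀
  odd-form : ∀ q → + 1 + q * + 2 ≡ + 1 + + 2 * q
  odd-form = solve-∀
  byRemainder : ∀ r → r ℕ.< 2 → d ≡ + r + q * + 2 → Odd d
  byRemainder 0 _ eq = contradiction (trans (sym odd) (trans (cong isOdd (trans eq (even-form q))) (isOdd-2* q))) λ ()
  byRemainder 1 _ eq = q , trans eq (odd-form q)
  byRemainder (suc (suc r)) (s≤s (s≤s ())) _

isOdd-≢⇒Odd-difference : ∀ a b → isOdd a ≢ isOdd b → Odd (a - b)
isOdd-≢⇒Odd-difference a b a≢b = isOdd⇒Odd (a - b) (begin
  isOdd (a - b)              ≡⟨ isOdd-+ a (- b) ⟩
  isOdd a xor isOdd (- b)    ≡⟨ cong₂ _xor_ (¬-not a≢b) (isOdd-neg b) ⟩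
  not (isOdd b) xor isOdd b  ≡⟨ xor-inverseˡ (isOdd b) ⟩
  true                       ∎)
  where open ≡-Reasoning

i+1-1≡i : ∀ i → i + + 1 - + 1 ≡ i
i+1-1≡i = solve-∀

i-1+1≡i : ∀ i → i - + 1 + + 1 ≡ i
i-1+1≡i = solve-∀

+1-injective : ∀ {i j} → i + + 1 ≡ j + + 1 → i ≡ j
+1-injective {i} {j} eq = trans (sym (i+1-1≡i i)) (trans (cong (_- + 1) eq) (i+1-1≡i j))

i≢i+1 : ∀ i → i ≢ i + + 1
i≢i+1 i eq = ℤ.i≢suc[i] (trans eq (ℤ.+-comm i (+ 1)))

i≢i+1+1 : ∀ i → i ≢ i + + 1 + + 1
i≢i+1+1 i eq = contradiction (trans (sym (ℤ.+-inverseʳ i)) (trans (cong (_- i) eq) (i+2-i≡2 i))) λ ()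
  where
  i+2-i≡2 : ∀ i → i + + 1 + + 1 - i ≡ + 2
  i+2-i≡2 = solve-∀

i≤i+1 : ∀ i → i ≤ i + + 1
i≤i+1 i = ℤ.i≤i+j i (+ 1)

i<j⇒i+1≤j : ∀ {i j} → i < j → i + + 1 ≤ j
i<j⇒i+1≤j {i} i<j = subst (_≤ _) (ℤ.+-comm (+ 1) i) (ℤ.i<j⇒suc[i]≤j i<j)

i+1≤j⇒i<j : ∀ {i j} → i + + 1 ≤ j → i < j
i+1≤j⇒i<j {i} le = ℤ.suc[i]≤j⇒i<j (subst (_≤ _) (ℤ.+-comm i (+ 1)) le)

i<j⇒i≤j-1 : ∀ {i j} → i < j → i ≤ j - + 1
i<j⇒i≤j-1 {i} {j} i<j = subst (_≤ j - + 1) (i+1-1≡i i) (ℤ.+-monoˡ-≤ (- + 1) (i<j⇒i+1≤j i<j))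

i≤j-1⇒i<j : ∀ {i j} → i ≤ j - + 1 → i < j
i≤j-1⇒i<j {i} {j} le = i+1≤j⇒i<j (subst (i + + 1 ≤_) (i-1+1≡i j) (ℤ.+-monoˡ-≤ (+ 1) le))

≤?-suc : ∀ y k → does (y ℤ.≤? k + + 1) ≡ does (y ℤ.≤? k) xor does (y ℤ.≟ k + + 1)
≤?-suc y k with y ℤ.≤? k | y ℤ.≟ k + + 1 | y ℤ.≤? k + + 1
... | yes _   | no _     | yes _    = refl
... | no _    | yes _    | yes _    = refl
... | no _    | no _     | no _     = refl
... | yes k+1≤k | yes refl | _      = contradiction (i+1≤j⇒i<j k+1≤k) (ℤ.<-irrefl refl)
... | yes y≤k | no _     | no y≰k+1 = contradiction (ℤ.≤-trans y≤k (i≤i+1 k)) y≰k+1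
... | no _    | yes refl | no y≰y   = contradiction ℤ.≤-refl y≰y
... | no y≰k  | no y≢k+1 | yes y≤k+1 =
  contradiction (ℤ.≤-antisym y≤k+1 (i<j⇒i+1≤j (ℤ.≰⇒> y≰k))) y≢k+1

≤?-xor-≤?-suc : ∀ y k → does (y ℤ.≤? k) xor does (y + + 1 ℤ.≤? k) ≡ does (y ℤ.≟ k)
≤?-xor-≤?-suc y k with y ℤ.≤? k | y + + 1 ℤ.≤? k | y ℤ.≟ k
... | yes _   | yes _   | no _      = refl
... | yes _   | no _    | yes _     = refl
... | no _    | no _    | no _      = refl
... | yes _   | yes y+1≤y | yes refl = contradiction (i+1≤j⇒i<j y+1≤y) (ℤ.<-irrefl refl)
... | yes y≤k | no y+1≰k  | no y≢k  = contradiction (i<j⇒i+1≤j (ℤ.≤∧≢⇒< y≤k y≢k)) y+1≰k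
... | no y≰k  | yes y+1≤k | _       = contradiction (ℤ.≤-trans (i≤i+1 y) y+1≤k) y≰k
... | no y≰y  | no _      | yes refl = contradiction ℤ.≤-refl y≰y

≟-suc : ∀ x c → does (x + + 1 ℤ.≟ c + + 1) ≡ does (x ℤ.≟ c)
≟-suc x c with x ℤ.≟ c
... | yes refl = dec-true (x + + 1 ℤ.≟ x + + 1) refl
... | no x≢c   = dec-false (x + + 1 ℤ.≟ c + + 1) (x≢c ∘ +1-injective)

xorSum : ℕ → (ℕ → Bool) → Bool
xorSum zero    f = false
xorSum (suc n) f = xorSum n f xor f n

xorSum-cong : ∀ n {f g} → (∀ m → m ℕ.< n → f m ≡ g m) → xorSum n f ≡ xorSum n g
xorSum-cong zero    _   = refl
xorSum-cong (suc n) f≗g = cong₂ _xor_ (xorSum-cong n (λ m m<n → f≗g m (ℕ.m<n⇒m<1+n m<n))) (f≗g n ℕ.≤-refl)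

xorSum-false : ∀ n {f} → (∀ m → m ℕ.< n → f m ≡ false) → xorSum n f ≡ false
xorSum-false zero    _   = refl
xorSum-false (suc n) f≗0 =
  cong₂ _xor_ (xorSum-false n (λ m m<n → f≗0 m (ℕ.m<n⇒m<1+n m<n))) (f≗0 n ℕ.≤-refl)

xorSum-xor : ∀ n (f g : ℕ → Bool) → xorSum n (λ m → f m xor g m) ≡ xorSum n f xor xorSum n g
xorSum-xor zero    f g = refl
xorSum-xor (suc n) f g = begin
  xorSum n (λ m → f m xor g m) xor (f n xor g n)        ≡⟨ cong (_xor (f n xor g n)) (xorSum-xor n f g) ⟩
  (xorSum n f xor xorSum n g) xor (f n xor g n)          ≡⟨ interchange (xorSum n f) (xorSum n g) (f n) (g n) ⟩
  (xorSum n f xor f n) xor (xorSum n g xor g n)          ∎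
  where open ≡-Reasoning

xorSum-telescope : ∀ n (f : ℕ → Bool) → xorSum n (λ m → f m xor f (suc m)) ≡ f 0 xor f n
xorSum-telescope zero    f = sym (xor-same (f 0))
xorSum-telescope (suc n) f = begin
  xorSum n (λ m → f m xor f (suc m)) xor (f n xor f (suc n))  ≡⟨ cong (_xor (f n xor f (suc n))) (xorSum-telescope n f) ⟩
  (f 0 xor f n) xor (f n xor f (suc n))                        ≡⟨ xor-cancel-middle (f 0) (f n) (f (suc n)) ⟩
  f 0 xor f (suc n)                                             ∎
  where open ≡-Reasoning

xorSum-unique : ∀ n (f : ℕ → Bool) k → k ℕ.< n → f k ≡ true → (∀ m → m ℕ.< n → f m ≡ true → m ≡ k) → xorSum n f ≡ true
xorSum-unique (suc n) f k k<1+n fk≡true unique with ℕ.m<1+n⇒m<n∨m≡n k<1+n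
... | inj₂ refl = cong₂ _xor_ (xorSum-false n below) fk≡true
  where
  below : ∀ m → m ℕ.< k → f m ≡ false
  below m m<k = ¬-not (λ fm≡true → ℕ.<⇒≢ m<k (unique m (ℕ.m<n⇒m<1+n m<k) fm≡true))
... | inj₁ k<n = cong₂ _xor_ (xorSum-unique n f k k<n fk≡true (λ m m<n → unique m (ℕ.m<n⇒m<1+n m<n))) top
  where
  top : f n ≡ false
  top = ¬-not (λ fn≡true → ℕ.<⇒≢ k<n (sym (unique n ℕ.≤-refl fn≡true)))

data Segment : Set where
  horizontal vertical : Point → Segment

low high : Segment → Point
low (horizontal p)        = p
low (vertical p)          = p
high (horizontal (x , y)) = (x + + 1 , y)
high (vertical (x , y))   = (x , y + + 1)

IsStitch : Pattern → Segment → Set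
IsStitch P (horizontal (x , y)) = IsHStitch P x y
IsStitch P (vertical (x , y))   = IsVStitch P x y

Joins : Segment → Point → Point → Set
Joins σ p q = (p ≡ low σ × q ≡ high σ) ⊎ (p ≡ high σ × q ≡ low σ)

weight : Point → ℤ
weight (x , y) = x + y

weight-high : ∀ σ → weight (high σ) ≡ weight (low σ) + + 1
weight-high (horizontal (x , y)) = x+1+y≡x+y+1 x y
  where
  x+1+y≡x+y+1 : ∀ x y → x + + 1 + y ≡ x + y + + 1
  x+1+y≡x+y+1 = solve-∀
weight-high (vertical (x , y))   = sym (ℤ.+-assoc x y (+ 1))

¬endpoints-swapped : ∀ σ τ → low σ ≡ high τ → high σ ≡ low τ → ⊥
¬endpoints-swapped σ τ lowσ≡highτ highσ≡lowτ = i≢i+1+1 (weight (low σ)) (begin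
  weight (low σ)              ≡⟨ cong weight lowσ≡highτ ⟩
  weight (high τ)             ≡⟨ weight-high τ ⟩
  weight (low τ) + + 1        ≡⟨ cong (λ p → weight p + + 1) highσ≡lowτ ⟨
  weight (high σ) + + 1       ≡⟨ cong (_+ + 1) (weight-high σ) ⟩
  weight (low σ) + + 1 + + 1  ∎)
  where
  open ≡-Reasoning

low-high-injective : ∀ σ τ → low σ ≡ low τ → high σ ≡ high τ → σ ≡ τ
low-high-injective (horizontal _) (horizontal _) refl _ = refl
low-high-injective (vertical _)   (vertical _)   refl _ = refl
low-high-injective (horizontal (x , y)) (vertical _) refl eq = contradiction (cong proj₁ eq) (i≢i+1 x ∘ sym)
low-high-injective (vertical (x , y)) (horizontal _) refl eq = contradiction (cong proj₁ eq) (i≢i+1 x)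

Joins-unique : ∀ {σ τ p q} → Joins σ p q → Joins τ p q → σ ≡ τ
Joins-unique {σ} {τ} (inj₁ (p≡ , q≡)) (inj₁ (p≡′ , q≡′)) = low-high-injective σ τ (trans (sym p≡) p≡′) (trans (sym q≡) q≡′)
Joins-unique {σ} {τ} (inj₂ (p≡ , q≡)) (inj₂ (p≡′ , q≡′)) = low-high-injective σ τ (trans (sym q≡) q≡′) (trans (sym p≡) p≡′)
Joins-unique {σ} {τ} (inj₁ (p≡ , q≡)) (inj₂ (p≡′ , q≡′)) = contradiction (trans (sym q≡) q≡′) (¬endpoints-swapped σ τ (trans (sym p≡) p≡′))
Joins-unique {σ} {τ} (inj₂ (p≡ , q≡)) (inj₁ (p≡′ , q≡′)) = contradiction (trans (sym p≡) p≡′) (¬endpoints-swapped σ τ (trans (sym q≡) q≡′))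

-- The cell (x , y) is the unit square with lower left corner (x , y).
record Colouring (P : Pattern) : Set where
  field
    colour          : Point → Bool
    jump            : Bool
    jump-horizontal : ∀ x y y′ → y′ ≡ y + + 1 → ¬ IsHStitch P x y′ → colour (x , y′) ≡ jump xor colour (x , y)
    jump-vertical   : ∀ x x′ y → x′ ≡ x + + 1 → ¬ IsVStitch P x′ y → colour (x′ , y) ≡ jump xor colour (x , y)

-- The four summands of StitchBetween are the steps east, west, north and south.
module Stitches (P : Pattern) where

  segment : ∀ {p q} → StitchBetween P p q → Segment
  segment {p}     {_}       (inj₁ _)                = horizontal p
  segment {_ , y} {x′ , _}  (inj₂ (inj₁ _))         = horizontal (x′ , y)
  segment {p}     {_}       (inj₂ (inj₂ (inj₁ _)))  = vertical p
  segment {x , _} {_ , y′}  (inj₂ (inj₂ (inj₂ _)))  = vertical (x , y′)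

  segment-joins : ∀ {p q} (s : StitchBetween P p q) → Joins (segment s) p q
  segment-joins (inj₁ (refl , refl , _))                = inj₁ (refl , refl)
  segment-joins (inj₂ (inj₁ (refl , refl , _)))         = inj₂ (refl , refl)
  segment-joins (inj₂ (inj₂ (inj₁ (refl , refl , _))))  = inj₁ (refl , refl)
  segment-joins (inj₂ (inj₂ (inj₂ (refl , refl , _))))  = inj₂ (refl , refl)

  segment-isStitch : ∀ {p q} (s : StitchBetween P p q) → IsStitch P (segment s)
  segment-isStitch (inj₁ (_ , _ , h))                   = h
  segment-isStitch (inj₂ (inj₁ (_ , refl , h)))         = h
  segment-isStitch (inj₂ (inj₂ (inj₁ (_ , _ , h))))     = h
  segment-isStitch (inj₂ (inj₂ (inj₂ (refl , _ , h))))  = h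

  leftCell : ∀ {p q} → StitchBetween P p q → Point
  leftCell {p}     {_}       (inj₁ _)                = p
  leftCell {_ , y} {x′ , _}  (inj₂ (inj₁ _))         = (x′ , y - + 1)
  leftCell {x , y} {_}       (inj₂ (inj₂ (inj₁ _)))  = (x - + 1 , y)
  leftCell {_}     {q}       (inj₂ (inj₂ (inj₂ _)))  = q

  leftCell-horizontal : ∀ {p q i j} (s : StitchBetween P p q) → segment s ≡ horizontal (i , j) →
                        leftCell s ≡ (i , j) ⊎ leftCell s ≡ (i , j - + 1)
  leftCell-horizontal (inj₁ _)        refl = inj₁ refl
  leftCell-horizontal (inj₂ (inj₁ _)) refl = inj₂ refl
  leftCell-horizontal (inj₂ (inj₂ (inj₁ _))) ()
  leftCell-horizontal (inj₂ (inj₂ (inj₂ _))) ()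

  module _ (F : Colouring P) where
    open Colouring F

    private
      ¬adjacent-hstitches : ∀ {x x′} y → x′ ≡ x + + 1 → IsHStitch P x y → IsHStitch P x′ y → ⊥
      ¬adjacent-hstitches y = ¬adjacent-≡₂ {t = bitℤ (η P y)}

      ¬adjacent-vstitches : ∀ {y y′} x → y′ ≡ y + + 1 → IsVStitch P x y → IsVStitch P x y′ → ⊥
      ¬adjacent-vstitches x = ¬adjacent-≡₂ {t = bitℤ (ε P x)}

      jumps-from-common : ∀ {A B C} → colour C ≡ jump xor colour A → colour C ≡ jump xor colour B → colour A ≡ colour B
      jumps-from-common {A} {B} C≡A C≡B = xor-cancelˡ jump (colour A) (colour B) (trans (sym C≡A) C≡B)

      jump-twice : ∀ {A B C} → colour C ≡ jump xor colour A → colour B ≡ jump xor colour C → colour A ≡ colour B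
      jump-twice {A} C≡A B≡C = sym (begin
        _                                 ≡⟨ B≡C ⟩
        jump xor colour _                 ≡⟨ cong (jump xor_) C≡A ⟩
        jump xor (jump xor colour A)      ≡⟨ xor-assoc jump jump (colour A) ⟨
        (jump xor jump) xor colour A      ≡⟨ cong (_xor colour A) (xor-same jump) ⟩
        colour A                          ∎)
        where open ≡-Reasoning

    -- At a left turn the two left cells coincide. At a right turn they are joined through the third
    -- cell at the corner, across the two segments extending the turn's stitches past the corner,
    -- which are not stitches because stitches alternate along every line; for the same reason the
    -- path cannot go straight on.
    leftCell-step : ∀ {p q r} (s : StitchBetween P p q) (s′ : StitchBetween P q r) → p ≢ r →
                    colour (leftCell s) ≡ colour (leftCell s′)
    leftCell-step {a , b} (inj₁ (refl , refl , h)) (inj₁ (_ , refl , h′)) _ = ⊥-elim (¬adjacent-hstitches b refl h h′)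
    leftCell-step {a , b} (inj₁ (refl , refl , h)) (inj₂ (inj₁ (eq , refl , _))) p≢r =
      ⊥-elim (p≢r (cong (_, b) (+1-injective eq)))
    leftCell-step {a , b} (inj₁ (refl , refl , h)) (inj₂ (inj₂ (inj₁ (refl , refl , _)))) _ =
      cong (λ x → colour (x , b)) (sym (i+1-1≡i a))
    leftCell-step {a , b} (inj₁ (refl , refl , h)) (inj₂ (inj₂ (inj₂ (refl , refl , v′)))) _ =
      jumps-from-common (jump-vertical a (a + + 1) b refl (¬adjacent-vstitches (a + + 1) refl v′))
                        (jump-horizontal (a + + 1) _ b refl (¬adjacent-hstitches b refl h))
    leftCell-step (inj₂ (inj₁ (refl , refl , _))) (inj₁ (refl , refl , _)) p≢r = ⊥-elim (p≢r refl)
    leftCell-step {_ , b} (inj₂ (inj₁ (refl , refl , h))) (inj₂ (inj₁ (refl , refl , h′))) _ =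
      ⊥-elim (¬adjacent-hstitches b refl h′ h)
    leftCell-step {_ , b} {a′ , _} (inj₂ (inj₁ (refl , refl , h))) (inj₂ (inj₂ (inj₁ (refl , refl , v′)))) _ =
      trans (jump-vertical (a′ - + 1) a′ (b - + 1) (sym (i-1+1≡i a′)) (λ v → ¬adjacent-vstitches a′ (sym (i-1+1≡i b)) v v′))
            (sym (jump-horizontal (a′ - + 1) (b - + 1) b (sym (i-1+1≡i b)) (λ h″ → ¬adjacent-hstitches b (sym (i-1+1≡i a′)) h″ h)))
    leftCell-step {_ , b} {a′ , _} (inj₂ (inj₁ (refl , refl , _))) (inj₂ (inj₂ (inj₂ (refl , refl , _)))) _ =
      cong (λ y → colour (a′ , y)) (i+1-1≡i _)
    leftCell-step {a , b} (inj₂ (inj₂ (inj₁ (refl , refl , v)))) (inj₁ (refl , refl , h′)) _ =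
      jump-twice (jump-horizontal (a - + 1) b (b + + 1) refl (λ h → ¬adjacent-hstitches (b + + 1) (sym (i-1+1≡i a)) h h′))
                 (jump-vertical (a - + 1) a (b + + 1) (sym (i-1+1≡i a)) (¬adjacent-vstitches a refl v))
    leftCell-step {a , b} {_ , _} {a″ , _} (inj₂ (inj₂ (inj₁ (refl , refl , _)))) (inj₂ (inj₁ (refl , refl , _))) _ =
      cong₂ (λ x y → colour (x , y)) (i+1-1≡i a″) (sym (i+1-1≡i b))
    leftCell-step {a , _} (inj₂ (inj₂ (inj₁ (refl , refl , v)))) (inj₂ (inj₂ (inj₁ (refl , refl , v′)))) _ =
      ⊥-elim (¬adjacent-vstitches a refl v v′)
    leftCell-step {a , _} (inj₂ (inj₂ (inj₁ (refl , refl , _)))) (inj₂ (inj₂ (inj₂ (refl , eq , _)))) p≢r =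
      ⊥-elim (p≢r (cong (a ,_) (+1-injective eq)))
    leftCell-step (inj₂ (inj₂ (inj₂ (refl , refl , _)))) (inj₁ (refl , refl , _)) _ = refl
    leftCell-step {_ , _} {_ , b′} {a″ , _} (inj₂ (inj₂ (inj₂ (refl , refl , v)))) (inj₂ (inj₁ (refl , refl , h′))) _ =
      sym (jump-twice (jump-vertical a″ (a″ + + 1) (b′ - + 1) refl (λ v″ → ¬adjacent-vstitches (a″ + + 1) (sym (i-1+1≡i b′)) v″ v))
                      (jump-horizontal (a″ + + 1) (b′ - + 1) b′ (sym (i-1+1≡i b′)) (¬adjacent-hstitches b′ refl h′)))
    leftCell-step (inj₂ (inj₂ (inj₂ (refl , refl , _)))) (inj₂ (inj₂ (inj₁ (refl , refl , _)))) p≢r = ⊥-elim (p≢r refl)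
    leftCell-step {a , _} (inj₂ (inj₂ (inj₂ (refl , refl , v)))) (inj₂ (inj₂ (inj₂ (refl , refl , v′)))) _ =
      ⊥-elim (¬adjacent-vstitches a refl v′ v)

checkerboard : (P : Pattern) → Colouring P
checkerboard P = record
  { colour          = λ (x , y) → isOdd x xor isOdd y
  ; jump            = true
  ; jump-horizontal = λ { x y _ refl _ → trans (cong (isOdd x xor_) (isOdd-suc y)) (sym (not-distribʳ-xor (isOdd x) (isOdd y))) }
  ; jump-vertical   = λ { x _ y refl _ → trans (cong (_xor isOdd y) (isOdd-suc x)) (sym (not-distribˡ-xor (isOdd x) (isOdd y))) }
  }

δ : (Point → Bool) → Segment → Bool
δ B σ = B (low σ) xor B (high σ)

Joins⇒δ : ∀ B {σ p q} → Joins σ p q → B p xor B q ≡ δ B σ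
Joins⇒δ B (inj₁ (refl , refl)) = refl
Joins⇒δ B {σ} (inj₂ (refl , refl)) = xor-comm (B (high σ)) (B (low σ))

Joins⇒≢ : ∀ {σ p q} → Joins σ p q → p ≢ q
Joins⇒≢ {σ} (inj₁ (refl , refl)) low≡high = i≢i+1 (weight (low σ)) (trans (cong weight low≡high) (weight-high σ))
Joins⇒≢ {σ} (inj₂ (refl , refl)) high≡low = i≢i+1 (weight (low σ)) (trans (cong weight (sym high≡low)) (weight-high σ))

onColumn : ℤ → (ℤ → Bool) → Segment → Bool
onColumn i f (horizontal (x , y)) = does (x ℤ.≟ i) ∧ f y
onColumn i f (vertical _)         = false

onColumn-xor : ∀ i f g σ → onColumn i (λ y → f y xor g y) σ ≡ onColumn i f σ xor onColumn i g σ
onColumn-xor i f g (horizontal (x , y)) = ∧-distribˡ-xor (does (x ℤ.≟ i)) (f y) (g y)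
onColumn-xor i f g (vertical _)         = refl

onColumn-false : ∀ i σ → onColumn i (λ _ → false) σ ≡ false
onColumn-false i (horizontal (x , _)) = ∧-zeroʳ (does (x ℤ.≟ i))
onColumn-false i (vertical _)         = refl

onColumn-point : ∀ {i j} σ → onColumn i (λ y → does (y ℤ.≟ j)) σ ≡ true → σ ≡ horizontal (i , j)
onColumn-point {i} {j} (horizontal (x , y)) eq with x ℤ.≟ i | y ℤ.≟ j
... | yes refl | yes refl = refl
onColumn-point (vertical _) ()

onVertical : Point → Segment → Bool
onVertical _       (horizontal _)      = false
onVertical (c , k) (vertical (x , y))  = does (x ℤ.≟ c) ∧ does (y ℤ.≟ k)

onVertical-point : ∀ {p} σ → onVertical p σ ≡ true → σ ≡ vertical p
onVertical-point {c , k} (vertical (x , y)) eq with x ℤ.≟ c | y ℤ.≟ k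
... | yes refl | yes refl = refl
onVertical-point (horizontal _) ()

δ-left-of : ∀ i σ → δ (λ (x , _) → does (x ℤ.≤? i)) σ ≡ onColumn i (λ _ → true) σ
δ-left-of i (horizontal (x , y)) = trans (≤?-xor-≤?-suc x i) (sym (∧-identityʳ (does (x ℤ.≟ i))))
δ-left-of i (vertical (x , y))   = xor-same (does (x ℤ.≤? i))

δ-column-below : ∀ c k σ → δ (λ (x , y) → does (x ℤ.≟ c + + 1) ∧ does (y ℤ.≤? k)) σ ≡
                 (onColumn (c + + 1) (λ y → does (y ℤ.≤? k)) σ xor onColumn c (λ y → does (y ℤ.≤? k)) σ)
                 xor onVertical (c + + 1 , k) σ
δ-column-below c k (horizontal (x , y)) = begin
  (does (x ℤ.≟ c + + 1) ∧ Y) xor (does (x + + 1 ℤ.≟ c + + 1) ∧ Y)  ≡⟨ cong (λ b → (does (x ℤ.≟ c + + 1) ∧ Y) xor (b ∧ Y)) (≟-suc x c) ⟩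
  (does (x ℤ.≟ c + + 1) ∧ Y) xor (does (x ℤ.≟ c) ∧ Y)              ≡⟨ xor-identityʳ _ ⟨
  ((does (x ℤ.≟ c + + 1) ∧ Y) xor (does (x ℤ.≟ c) ∧ Y)) xor false  ∎
  where
  open ≡-Reasoning
  Y : Bool
  Y = does (y ℤ.≤? k)
δ-column-below c k (vertical (x , y)) = begin
  (X ∧ does (y ℤ.≤? k)) xor (X ∧ does (y + + 1 ℤ.≤? k))  ≡⟨ ∧-distribˡ-xor X _ _ ⟨
  X ∧ (does (y ℤ.≤? k) xor does (y + + 1 ℤ.≤? k))        ≡⟨ cong (X ∧_) (≤?-xor-≤?-suc y k) ⟩
  X ∧ does (y ℤ.≟ k)                                     ∎
  where
  open ≡-Reasoning
  X : Bool
  X = does (x ℤ.≟ c + + 1)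

module Loop {P : Pattern} (L : HitomezashiLoop P) where
  open Stitches P
  open Colouring

  edge : ∀ m → StitchBetween P (v L m) (v L (suc m))
  edge = stitches L

  seg : ℕ → Segment
  seg m = segment (edge m)

  private
    m<2+m : ∀ {m} → m ℕ.< suc (suc m)
    m<2+m = ℕ.m<n⇒m<1+n (ℕ.n<1+n _)

    0<n : 0 ℕ.< n L
    0<n = ℕ.<-≤-trans (s≤s ℕ.z≤n) (n≥3 L)

  no-backtrack : ∀ m → suc (suc m) ℕ.≤ n L → v L m ≢ v L (suc (suc m))
  no-backtrack m 2+m≤n eq with ℕ.m≤n⇒m<n∨m≡n 2+m≤n
  ... | inj₁ 2+m<n = ℕ.<⇒≢ m<2+m (simple L m (suc (suc m)) (ℕ.<-trans m<2+m 2+m<n) 2+m<n eq)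
  ... | inj₂ 2+m≡n with simple L m 0 (ℕ.<-≤-trans m<2+m 2+m≤n) 0<n (trans eq (trans (cong (v L) 2+m≡n) (periodic L 0)))
  ...   | refl = ℕ.<-irrefl 2+m≡n (n≥3 L)

  leftCell-invariant : (F : Colouring P) → ∀ m → m ℕ.< n L → colour F (leftCell (edge m)) ≡ colour F (leftCell (edge 0))
  leftCell-invariant F zero    _     = refl
  leftCell-invariant F (suc m) 1+m<n =
    trans (sym (leftCell-step F (edge m) (edge (suc m)) (no-backtrack m 1+m<n)))
          (leftCell-invariant F m (ℕ.<-trans (ℕ.n<1+n m) 1+m<n))

  private
    reversed-later-edge-absurd : ∀ {m m′} → m ℕ.< m′ → m′ ℕ.< n L → v L m ≡ v L (suc m′) → v L (suc m) ≡ v L m′ → ⊥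
    reversed-later-edge-absurd m<m′ m′<n e₁ e₂ with simple L _ _ (ℕ.≤-<-trans m<m′ m′<n) m′<n e₂
    ... | refl = no-backtrack _ m′<n e₁

  reversed-edges-absurd : ∀ {m m′} → m ℕ.< n L → m′ ℕ.< n L → v L m ≡ v L (suc m′) → v L (suc m) ≡ v L m′ → ⊥
  reversed-edges-absurd {m} {m′} m<n m′<n e₁ e₂ with ℕ.<-cmp m m′
  ... | tri< m<m′ _ _ = reversed-later-edge-absurd m<m′ m′<n e₁ e₂
  ... | tri≈ _ refl _ = Joins⇒≢ (segment-joins (edge m)) (sym e₂)
  ... | tri> _ _ m′<m = reversed-later-edge-absurd m′<m m<n (sym e₂) (sym e₁)

  seg-injective : ∀ {m m′} → m ℕ.< n L → m′ ℕ.< n L → seg m ≡ seg m′ → m ≡ m′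
  seg-injective {m} {m′} m<n m′<n seg≡ with segment-joins (edge m) | subst (λ σ → Joins σ _ _) (sym seg≡) (segment-joins (edge m′))
  ... | inj₁ (e₁ , _)  | inj₁ (e₁′ , _)  = simple L m m′ m<n m′<n (trans e₁ (sym e₁′))
  ... | inj₂ (e₁ , _)  | inj₂ (e₁′ , _)  = simple L m m′ m<n m′<n (trans e₁ (sym e₁′))
  ... | inj₁ (e₁ , e₂) | inj₂ (e₁′ , e₂′) = ⊥-elim (reversed-edges-absurd m<n m′<n (trans e₁ (sym e₂′)) (trans e₂ (sym e₁′)))
  ... | inj₂ (e₁ , e₂) | inj₁ (e₁′ , e₂′) = ⊥-elim (reversed-edges-absurd m<n m′<n (trans e₁ (sym e₂′)) (trans e₂ (sym e₁′)))

  HStitchOf⇒seg : ∀ {i j} → HStitchOf L i j → ∃[ m ] m ℕ.< n L × seg m ≡ horizontal (i , j)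
  HStitchOf⇒seg (m , m<n , joins) = m , m<n , Joins-unique (segment-joins (edge m)) joins

  seg⇒HStitchOf : ∀ {m i j} → m ℕ.< n L → seg m ≡ horizontal (i , j) → HStitchOf L i j
  seg⇒HStitchOf {m} m<n seg≡ = m , m<n , subst (λ σ → Joins σ _ _) seg≡ (segment-joins (edge m))

  HStitchOf⇒IsHStitch : ∀ {i j} → HStitchOf L i j → IsHStitch P i j
  HStitchOf⇒IsHStitch st with HStitchOf⇒seg st
  ... | m , _ , seg≡ = subst (IsStitch P) seg≡ (segment-isStitch (edge m))

  columnSum : ℤ → (ℤ → Bool) → Bool
  columnSum i f = xorSum (n L) (onColumn i f ∘ seg)

  columnSum-cong : ∀ i {f g} → (∀ y → HStitchOf L i y → f y ≡ g y) → columnSum i f ≡ columnSum i g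
  columnSum-cong i {f} {g} f≗g = xorSum-cong (n L) pointwise
    where
    pointwise : ∀ m → m ℕ.< n L → onColumn i f (seg m) ≡ onColumn i g (seg m)
    pointwise m m<n with seg m in seg≡
    ... | vertical _ = refl
    ... | horizontal (x , y) with x ℤ.≟ i
    ...   | no _     = refl
    ...   | yes refl = f≗g y (seg⇒HStitchOf m<n seg≡)

  columnSum-xor : ∀ i f g → columnSum i (λ y → f y xor g y) ≡ columnSum i f xor columnSum i g
  columnSum-xor i f g = trans (xorSum-cong (n L) (λ m _ → onColumn-xor i f g (seg m))) (xorSum-xor (n L) _ _)

  columnSum-vanishes : ∀ i {f} → (∀ y → HStitchOf L i y → f y ≡ false) → columnSum i f ≡ false
  columnSum-vanishes i f≗false =
    trans (columnSum-cong i f≗false) (xorSum-false (n L) (λ m _ → onColumn-false i (seg m)))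

  columnSum-point : ∀ {i j} → HStitchOf L i j → columnSum i (λ y → does (y ℤ.≟ j)) ≡ true
  columnSum-point {i} {j} st with HStitchOf⇒seg st
  ... | m , m<n , seg≡ = xorSum-unique (n L) _ m m<n at-m only-m
    where
    at-m : onColumn i (λ y → does (y ℤ.≟ j)) (seg m) ≡ true
    at-m rewrite seg≡ | dec-true (i ℤ.≟ i) refl | dec-true (j ℤ.≟ j) refl = refl
    only-m : ∀ m′ → m′ ℕ.< n L → onColumn i (λ y → does (y ℤ.≟ j)) (seg m′) ≡ true → m′ ≡ m
    only-m m′ m′<n hit = seg-injective m′<n m<n (trans (onColumn-point (seg m′) hit) (sym seg≡))

  -- Stokes' theorem mod 2: the loop is a cycle, so its mod-2 boundary vanishes.
  xorSum-δ : ∀ B → xorSum (n L) (δ B ∘ seg) ≡ false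
  xorSum-δ B = begin
    xorSum (n L) (δ B ∘ seg)                             ≡⟨ xorSum-cong (n L) (λ m _ → Joins⇒δ B (segment-joins (edge m))) ⟨
    xorSum (n L) (λ m → B (v L m) xor B (v L (suc m)))   ≡⟨ xorSum-telescope (n L) (B ∘ v L) ⟩
    B (v L 0) xor B (v L (n L))                          ≡⟨ cong (λ p → B (v L 0) xor B p) (periodic L 0) ⟩
    B (v L 0) xor B (v L 0)                              ≡⟨ xor-same (B (v L 0)) ⟩
    false                                                ∎
    where open ≡-Reasoning

  columnSum-even : ∀ i → columnSum i (λ _ → true) ≡ false
  columnSum-even i = trans (xorSum-cong (n L) (λ m _ → sym (δ-left-of i (seg m)))) (xorSum-δ (λ (x , _) → does (x ℤ.≤? i)))

  -- The crossing-number definition of the inside of L, with downward rays.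
  inside : Point → Bool
  inside (x , y) = columnSum x (λ y′ → does (y′ ℤ.≤? y))

  inside-suc : ∀ x y → inside (x , y + + 1) ≡ inside (x , y) xor columnSum x (λ y′ → does (y′ ℤ.≟ y + + 1))
  inside-suc x y = trans (columnSum-cong x (λ y′ _ → ≤?-suc y′ y)) (columnSum-xor x _ _)

  inside-flip : ∀ {i j} → HStitchOf L i j → inside (i , j) ≡ not (inside (i , j - + 1))
  inside-flip {i} {j} st = begin
    inside (i , j)                                                  ≡⟨ cong (λ y → inside (i , y)) (i-1+1≡i j) ⟨
    inside (i , j - + 1 + + 1)                                      ≡⟨ inside-suc i (j - + 1) ⟩
    inside (i , j - + 1) xor columnSum i (λ y → does (y ℤ.≟ j - + 1 + + 1)) ≡⟨ cong (λ k → inside (i , j - + 1) xor columnSum i (λ y → does (y ℤ.≟ k))) (i-1+1≡i j) ⟩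
    inside (i , j - + 1) xor columnSum i (λ y → does (y ℤ.≟ j))    ≡⟨ cong (inside (i , j - + 1) xor_) (columnSum-point st) ⟩
    inside (i , j - + 1) xor true                                   ≡⟨ xor-comm (inside (i , j - + 1)) true ⟩
    not (inside (i , j - + 1))                                      ∎
    where open ≡-Reasoning

  insideColouring : Colouring P
  insideColouring = record
    { colour          = inside
    ; jump            = false
    ; jump-horizontal = λ { x y _ refl ¬stitch → trans (inside-suc x y) (trans (cong (inside (x , y) xor_) (no-stitch-here ¬stitch)) (xor-identityʳ _)) }
    ; jump-vertical   = λ { x _ y refl ¬stitch → xor≡false⇒≡ (across-vertical x y ¬stitch) }
    }
    where
    no-stitch-here : ∀ {x k} → ¬ IsHStitch P x k → columnSum x (λ y → does (y ℤ.≟ k)) ≡ false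
    no-stitch-here {x} {k} ¬stitch = columnSum-vanishes x (λ y st → dec-false (y ℤ.≟ k) λ { refl → ¬stitch (HStitchOf⇒IsHStitch st) })
    across-vertical : ∀ x y → ¬ IsVStitch P (x + + 1) y → inside (x + + 1 , y) xor inside (x , y) ≡ false
    across-vertical x y ¬stitch = begin
      inside (x + + 1 , y) xor inside (x , y)                            ≡⟨ xor-identityʳ _ ⟨
      (inside (x + + 1 , y) xor inside (x , y)) xor false                ≡⟨ cong ((inside (x + + 1 , y) xor inside (x , y)) xor_) no-vertical ⟨
      (inside (x + + 1 , y) xor inside (x , y)) xor total (onVertical (x + + 1 , y)) ≡⟨ cong (_xor total (onVertical (x + + 1 , y))) (xorSum-xor (n L) _ _) ⟨
      total (λ σ → onColumn (x + + 1) below σ xor onColumn x below σ) xor total (onVertical (x + + 1 , y)) ≡⟨ xorSum-xor (n L) _ _ ⟨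
      total (λ σ → (onColumn (x + + 1) below σ xor onColumn x below σ) xor onVertical (x + + 1 , y) σ) ≡⟨ xorSum-cong (n L) (λ m _ → δ-column-below x y (seg m)) ⟨
      total (δ B)                                                            ≡⟨ xorSum-δ B ⟩
      false                                                              ∎
      where
      open ≡-Reasoning
      total : (Segment → Bool) → Bool
      total f = xorSum (n L) (f ∘ seg)
      below : ℤ → Bool
      below y′ = does (y′ ℤ.≤? y)
      B : Point → Bool
      B (x′ , y′) = does (x′ ℤ.≟ x + + 1) ∧ below y′
      no-vertical : xorSum (n L) (onVertical (x + + 1 , y) ∘ seg) ≡ false
      no-vertical = xorSum-false (n L) λ m _ → ¬-not λ hit → ¬stitch (subst (IsStitch P) (onVertical-point (seg m) hit) (segment-isStitch (edge m)))

  -- Inside values differ across each stitch and agree on all left cells, so the left cells of the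
  -- two stitches are one above its stitch and one below; their equal colours make r₂ - r₁ odd.
  odd-gap : ∀ {i r₁ r₂} → HStitchOf L i r₁ → HStitchOf L i r₂ →
            inside (i , r₁) ≡ inside (i , r₂ - + 1) → Odd (r₂ - r₁)
  odd-gap {i} {r₁} {r₂} st₁ st₂ same-side with HStitchOf⇒seg st₁ | HStitchOf⇒seg st₂
  ... | m₁ , m₁<n , seg₁ | m₂ , m₂<n , seg₂ =
    by-cases (leftCell-horizontal (edge m₁) seg₁) (leftCell-horizontal (edge m₂) seg₂)
    where
    agree : (F : Colouring P) → ∀ {c₁ c₂} → leftCell (edge m₁) ≡ c₁ → leftCell (edge m₂) ≡ c₂ → colour F c₁ ≡ colour F c₂
    agree F refl refl = trans (leftCell-invariant F m₁ m₁<n) (sym (leftCell-invariant F m₂ m₂<n))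
    parity-agree : ∀ {c₁ c₂} → leftCell (edge m₁) ≡ (i , c₁) → leftCell (edge m₂) ≡ (i , c₂) → isOdd c₁ ≡ isOdd c₂
    parity-agree ℓ₁ ℓ₂ = xor-cancelˡ (isOdd i) _ _ (agree (checkerboard P) ℓ₁ ℓ₂)
    x≢not-x : ∀ {x} → x ≢ not x
    x≢not-x = not-¬ refl
    by-cases : leftCell (edge m₁) ≡ (i , r₁) ⊎ leftCell (edge m₁) ≡ (i , r₁ - + 1) →
               leftCell (edge m₂) ≡ (i , r₂) ⊎ leftCell (edge m₂) ≡ (i , r₂ - + 1) → Odd (r₂ - r₁)
    by-cases (inj₁ ℓ₁) (inj₁ ℓ₂) = contradiction
      (trans (agree insideColouring ℓ₁ ℓ₂) (trans (inside-flip st₂) (cong not (sym same-side)))) x≢not-x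
    by-cases (inj₂ ℓ₁) (inj₂ ℓ₂) = contradiction
      (trans (agree insideColouring ℓ₁ ℓ₂) (trans (sym same-side) (inside-flip st₁))) x≢not-x
    by-cases (inj₁ ℓ₁) (inj₂ ℓ₂) = isOdd-≢⇒Odd-difference r₂ r₁
      λ r₂≡r₁ → x≢not-x (trans r₂≡r₁ (trans (parity-agree ℓ₁ ℓ₂) (isOdd-pred r₂)))
    by-cases (inj₂ ℓ₁) (inj₁ ℓ₂) = isOdd-≢⇒Odd-difference r₂ r₁
      λ r₂≡r₁ → x≢not-x (trans (sym r₂≡r₁) (trans (sym (parity-agree ℓ₁ ℓ₂)) (isOdd-pred r₁)))

  consecutive-odd : ∀ i (j₁ j₂ : ℤ) → HStitchOf L i j₁ → HStitchOf L i j₂ → j₁ < j₂ →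
                    ((j : ℤ) → HStitchOf L i j → j₁ < j → j < j₂ → ⊥) → Odd (j₂ - j₁)
  consecutive-odd i j₁ j₂ st₁ st₂ j₁<j₂ none-between = odd-gap st₁ st₂ (columnSum-cong i same-side)
    where
    same-side : ∀ y → HStitchOf L i y → does (y ℤ.≤? j₁) ≡ does (y ℤ.≤? j₂ - + 1)
    same-side y st with y ℤ.≤? j₁
    ... | yes y≤j₁ = sym (dec-true (y ℤ.≤? j₂ - + 1) (ℤ.≤-trans y≤j₁ (i<j⇒i≤j-1 j₁<j₂)))
    ... | no y≰j₁  = sym (dec-false (y ℤ.≤? j₂ - + 1) (none-between y st (ℤ.≰⇒> y≰j₁) ∘ i≤j-1⇒i<j))

  extremal-odd : ∀ i (jN jS : ℤ) → HStitchOf L i jN → HStitchOf L i jS →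
                 ((j : ℤ) → HStitchOf L i j → j ≤ jN) → ((j : ℤ) → HStitchOf L i j → jS ≤ j) → Odd (jN - jS)
  extremal-odd i jN jS stN stS ≤jN jS≤ = odd-gap stS stN (begin
    inside (i , jS)               ≡⟨ inside-flip stS ⟩
    not (inside (i , jS - + 1))   ≡⟨ cong not nothing-below ⟩
    true                          ≡⟨ cong not all-below ⟨
    not (inside (i , jN))         ≡⟨ cong not (inside-flip stN) ⟩
    not (not (inside (i , jN - + 1))) ≡⟨ not-involutive _ ⟩
    inside (i , jN - + 1)         ∎)
    where
    open ≡-Reasoning
    nothing-below : inside (i , jS - + 1) ≡ false
    nothing-below = columnSum-vanishes i λ y st → dec-false (y ℤ.≤? jS - + 1) (λ y≤jS-1 → ℤ.<⇒≱ (i≤j-1⇒i<j y≤jS-1) (jS≤ y st))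
    all-below : inside (i , jN) ≡ false
    all-below = trans (columnSum-cong i λ y st → dec-true (y ℤ.≤? jN) (≤jN y st)) (columnSum-even i)

transposePattern : Pattern → Pattern
transposePattern P = record { ε = η P ; η = ε P }

transposeStitch : ∀ P {p q} → StitchBetween P p q → StitchBetween (transposePattern P) (swap p) (swap q)
transposeStitch P (inj₁ (e₁ , e₂ , h))                = inj₂ (inj₂ (inj₁ (e₂ , e₁ , h)))
transposeStitch P (inj₂ (inj₁ (e₁ , e₂ , h)))         = inj₂ (inj₂ (inj₂ (e₂ , e₁ , h)))
transposeStitch P (inj₂ (inj₂ (inj₁ (e₁ , e₂ , h))))  = inj₁ (e₂ , e₁ , h)
transposeStitch P (inj₂ (inj₂ (inj₂ (e₁ , e₂ , h))))  = inj₂ (inj₁ (e₂ , e₁ , h))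

transposeLoop : ∀ {P} → HitomezashiLoop P → HitomezashiLoop (transposePattern P)
transposeLoop {P} L = record
  { n        = n L
  ; n≥3      = n≥3 L
  ; v        = swap ∘ v L
  ; periodic = cong swap ∘ periodic L
  ; simple   = λ k l k<n l<n eq → simple L k l k<n l<n (cong swap eq)
  ; stitches = transposeStitch P ∘ stitches L
  }

VStitchOf⇒HStitchOf : ∀ {P} (L : HitomezashiLoop P) {i j} → VStitchOf L i j → HStitchOf (transposeLoop L) j i
VStitchOf⇒HStitchOf L (m , m<n , inj₁ (e₁ , e₂)) = m , m<n , inj₁ (cong swap e₁ , cong swap e₂)
VStitchOf⇒HStitchOf L (m , m<n , inj₂ (e₁ , e₂)) = m , m<n , inj₂ (cong swap e₁ , cong swap e₂)

HStitchOf⇒VStitchOf : ∀ {P} (L : HitomezashiLoop P) {i j} → HStitchOf (transposeLoop L) j i → VStitchOf L i j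
HStitchOf⇒VStitchOf L (m , m<n , inj₁ (e₁ , e₂)) = m , m<n , inj₁ (cong swap e₁ , cong swap e₂)
HStitchOf⇒VStitchOf L (m , m<n , inj₂ (e₁ , e₂)) = m , m<n , inj₂ (cong swap e₁ , cong swap e₂)

proposition2p4 : (P : Pattern) (L : HitomezashiLoop P) →
    ((i : ℤ) → (∃[ j ] HStitchOf L i j) →
      ((j₁ j₂ : ℤ) → HStitchOf L i j₁ → HStitchOf L i j₂ → j₁ < j₂ →
         ((j : ℤ) → HStitchOf L i j → j₁ < j → j < j₂ → ⊥) →
         Odd (j₂ - j₁))
      × ((jN jS : ℤ) → HStitchOf L i jN → HStitchOf L i jS →
         ((j : ℤ) → HStitchOf L i j → j ≤ jN) →
         ((j : ℤ) → HStitchOf L i j → jS ≤ j) →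
         Odd (jN - jS)))
    ×
    ((j : ℤ) → (∃[ i ] VStitchOf L i j) →
      ((i₁ i₂ : ℤ) → VStitchOf L i₁ j → VStitchOf L i₂ j → i₁ < i₂ →
         ((i : ℤ) → VStitchOf L i j → i₁ < i → i < i₂ → ⊥) →
         Odd (i₂ - i₁))
      × ((iE iW : ℤ) → VStitchOf L iE j → VStitchOf L iW j →
         ((i : ℤ) → VStitchOf L i j → i ≤ iE) →
         ((i : ℤ) → VStitchOf L i j → iW ≤ i) →
         Odd (iE - iW)))
proposition2p4 P L =
    (λ i _ → Loop.consecutive-odd L i , Loop.extremal-odd L i)
  , (λ j _ →
      (λ i₁ i₂ st₁ st₂ i₁<i₂ none-between →
         Loop.consecutive-odd Lᵀ j i₁ i₂ (toH st₁) (toH st₂) i₁<i₂ (λ i → none-between i ∘ toV))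
    , (λ iE iW stE stW ≤iE iW≤ →
         Loop.extremal-odd Lᵀ j iE iW (toH stE) (toH stW) (λ i → ≤iE i ∘ toV) (λ i → iW≤ i ∘ toV)))
  where
  Lᵀ : HitomezashiLoop (transposePattern P)
  Lᵀ = transposeLoop L
  toH : ∀ {i j} → VStitchOf L i j → HStitchOf Lᵀ j i
  toH = VStitchOf⇒HStitchOf L
  toV : ∀ {i j} → HStitchOf Lᵀ j i → VStitchOf L i j
  toV = HStitchOf⇒VStitchOf L
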